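{- Let $x,y$ be real numbers with $y\neq 0$, $x+y\neq 0$ and $x/(x+y)\geq 0$, let $z\in(-\infty,1]$, and let $n,p,m$ be positive integers. Then \[ \sum_{k=0}^n x^ky^{n-k}\binom{n}{k}\, \zeta_k^\star(\{1\}_{p-1},m+1;z) =(-1)^{m+p}(x+y)^n \sum_{n\geq j\geq l\geq 1} \left(\frac{y}{x+y}\right)^j \left( \left(1+\frac{xz}{y}\right)^l-1\right)\left\{\sum_{i=0}^{p-1} (-1)^i \frac{Y_i(n)}{i!}\, \frac{s(j,p-i)}{j!}\right\}\left\{\sum_{h=0}^{m-1} (-1)^h \frac{Y_h(j)}{h!}\, \frac{s(l,m-h)}{l!}\right\}. \]
   Context: For a composition $\mathbf{k}=(k_1,\ldots,k_r)$ of positive integers, an integer $n\geq 0$ and a real $z$, define $\zeta^\star_n(\mathbf{k};z):=\sum_{n\geq n_1\geq\cdots\geq n_r\geq 1} \frac{z^{n_r}}{n_1^{k_1}\cdots n_r^{k_r}}$ (an empty sum, equal to $0$, when $n=0$). Here $(\{1\}_{p-1},m+1)$ is the composition $(1,\ldots,1,m+1)$ with $p-1$ ones followed by $m+1$. The convention $0^0=1$ is used. $s(n,k)$ denotes the unsigned Stirling numbers of the first kind: $s(0,0)=1$, $s(n,0)=s(0,k)=0$ for $n,k\geq1$, and $s(n,k)=s(n-1,k-1)+(n-1)s(n-1,k)$ for $n,k\geq1$. For $n\geq0,k\geq1$ let $H_n^{(k)}=\sum_{j=1}^n j^{ -k}$, $H_n=H_n^{(1)}$. The complete exponential Bell polynomials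 are defined by $\exp\big(\sum_{i\geq1} x_i t^i/i!\big)=\sum_{k\geq0} Y_k(x_1,\ldots,x_k)\,t^k/k!$, and $Y_k(n):=Y_k\big(H_n,1!H_n^{(2)},\ldots,(k-1)!H_n^{(k)}\big)$, with $Y_0(n)=1$. -}

module Defs where

open import Data.Nat as ℕ using (ℕ; zero; suc; _∸_)
open import Data.Nat.Combinatorics using (_C_)
open import Data.Nat.Base using (_!)
open import Data.List using (List; []; _∷_; _++_; replicate)
open import Relation.Binary.PropositionalEquality using (_≡_)
open import Relation.Nullary using (¬_)
open import Relation.Binary.Structures using (IsTotalOrder)
open import Algebra.Structures using (IsCommutativeRing)

-- An ordered field (real numbers are an instance), with a total inverse
-- function whose only specified behaviour is on nonzero elements.
record OrderedField : Set₁ where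
  infixl 6 _+_
  infixl 7 _*_
  infix  4 _≤_
  field
    Carrier : Set
    _+_ _*_ : Carrier → Carrier → Carrier
    -_      : Carrier → Carrier
    0# 1#   : Carrier
    _⁻¹     : Carrier → Carrier
    _≤_     : Carrier → Carrier → Set
    isCommutativeRing : IsCommutativeRing _≡_ _+_ _*_ -_ 0# 1#
    0≢1     : ¬ (0# ≡ 1#)
    inverseʳ : ∀ x → ¬ (x ≡ 0#) → x * (x ⁻¹) ≡ 1#
    isTotalOrder : IsTotalOrder _≡_ _≤_
    +-mono-≤ : ∀ {x y} z → x ≤ y → x + z ≤ y + z
    *-nonneg : ∀ {x y} → 0# ≤ x → 0# ≤ y → 0# ≤ x * y

module OF (𝔽 : OrderedField) where
  open OrderedField 𝔽 public

  F : Set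
  F = Carrier

  _-_ : F → F → F
  a - b = a + (- b)

  fromℕ : ℕ → F
  fromℕ zero    = 0#
  fromℕ (suc n) = 1# + fromℕ n

  _^_ : F → ℕ → F
  a ^ zero  = 1#
  a ^ suc k = a * (a ^ k)

  sum0 : ℕ → (ℕ → F) → F
  sum0 zero    f = f 0
  sum0 (suc n) f = sum0 n f + f (suc n)

  sum1 : ℕ → (ℕ → F) → F
  sum1 zero    f = 0#
  sum1 (suc n) f = sum1 n f + f (suc n)

  invPow : ℕ → ℕ → F
  invPow j k = (fromℕ j ^ k) ⁻¹

  -- zsAux z prev ks n = Σ_{n ≥ n₁ ≥ ⋯ ≥ n_r ≥ 1} z^{n_r}/(n₁^{k₁}⋯n_r^{k_r}),
  -- where for ks = [] the value is z^{prev} (prev = the last chosen index).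
  zsAux : F → ℕ → List ℕ → ℕ → F
  zsAux z prev []       n = z ^ prev
  zsAux z prev (k ∷ ks) n = sum1 n (λ j → invPow j k * zsAux z j ks j)

  zetaStar : ℕ → List ℕ → F → F
  zetaStar n ks z = zsAux z 0 ks n

  comp : ℕ → ℕ → List ℕ
  comp p m = replicate (p ∸ 1) 1 ++ (suc m ∷ [])

  H : ℕ → ℕ → F
  H n k = sum1 n (λ j → invPow j k)

  -- complete Bell polynomial Y_k(n) = Y_k(H_n, 1! H_n^{(2)}, …, (k-1)! H_n^{(k)}),
  -- via the standard recurrence Y_{k+1} = Σ_{i=0}^{k} C(k,i) x_{i+1} Y_{k-i}
  -- with x_{i+1} = i! H_n^{(i+1)}; the first argument is fuel (≥ k).
  YF : ℕ → ℕ → ℕ → F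
  YF n _        zero    = 1#
  YF n zero     (suc k) = 0#
  YF n (suc f) (suc k) =
    sum0 k (λ i → fromℕ (k C i) * (fromℕ (i !) * H n (suc i)) * YF n f (k ∸ i))

  Y : ℕ → ℕ → F
  Y k n = YF n k k

  sgn : ℕ → F
  sgn i = (- 1#) ^ i

stirling : ℕ → ℕ → ℕ
stirling zero    zero    = 1
stirling zero    (suc k) = 0
stirling (suc n) zero    = 0
stirling (suc n) (suc k) = stirling n k ℕ.+ n ℕ.* stirling n (suc k)

-- Write ζ_p(k) = ζ⋆_k({1}_{p-1}, m+1; z) and T d n = Σ_k C(n,k) x^k y^{n-k} d(k) for the
-- binomial transform.  Peeling off the first index gives ζ_{p+1}(k+1) = ζ_{p+1}(k) + ζ_p(k+1)/(k+1),
-- which Pascal's rule turns into T ζ_{p+1} (n+1) = (x+y) T ζ_{p+1} n + T ζ_p (n+1)/(n+1); at the bottom,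
-- T ζ_1 is driven by the binomial transform of z^k/k^m, which satisfies recurrences of the same shape
-- (with y in place of x+y) down to Σ_k C(n,k) (xz)^k y^{n-k} = (xz+y)^n − y^n.  The (k+1)-fold iterated
-- solution of g(n+1) = w g(n) + f(n+1)/(n+1), g(0) = 0, has the explicit kernel w^{n-j} (−1)^k G(n,j−1,k)/j,
-- where G(a,b,k) is the coefficient of t^k in Π_{i≤b}(1+t/i) / Π_{i≤a}(1+t/i): the recurrences of the
-- kernel are those of G under a ↦ a+1 and b ↦ b+1, and G(a,a,k+1) = 0.  Expanding G through
-- h_i(1,…,1/a) = Y_i(a)/i! (both satisfy Newton's identity with the power sums H_a^{(r)}) and
-- e_t(1,…,1/b) = s(b+1,t+1)/b! yields the Stirling–Bell sums of the statement.  Division by factorials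
-- is legitimate because an ordered field has characteristic zero.

module Submission where

open import Algebra.Bundles using (CommutativeRing)
open import Algebra.Structures using (IsCommutativeRing)
import Algebra.Properties.AbelianGroup as AbelianGroupProperties
import Algebra.Properties.CommutativeSemigroup as CommutativeSemigroupProperties
import Algebra.Properties.Ring as RingProperties
import Algebra.Solver.Ring
open import Algebra.Solver.Ring.AlmostCommutativeRing
  using (fromCommutativeRing; _-Raw-AlmostCommutative⟶_)
open import Data.Empty using (⊥-elim)
open import Data.Integer as ℤ using (ℤ; -[1+_]; _⊖_; sign; ∣_∣; _◃_)
import Data.Integer.Properties as ℤ
open import Data.Maybe using (Maybe; just; nothing)
open import Data.Nat as ℕ using (ℕ; zero; suc; _∸_; _≥_; z≤n; s≤s; _!)
open import Data.Nat.Combinatorics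
  using (_C_; k>n⇒nCk≡0; nCk+nC[k+1]≡[n+1]C[k+1]; nCk≡n!/k![n-k]!; k![n∸k]!∣n!)
open import Data.Nat.DivMod using (m/n*n≡m)
import Data.Nat.Properties as ℕ
open import Data.Nat.Tactic.RingSolver using (solve-∀)
open import Data.Sign as Sign using (Sign)
open import Data.Sum using (inj₁; inj₂)
open import Function using (_∘_)
open import Relation.Binary.PropositionalEquality
open import Relation.Binary.Structures using (IsTotalOrder)
open import Relation.Nullary using (¬_; yes; no)

open import Defs

nCk*[k!*[n∸k]!]≡n! : ∀ {n k} → k ℕ.≤ n → (n C k) ℕ.* (k ! ℕ.* (n ∸ k) !) ≡ n !
nCk*[k!*[n∸k]!]≡n! {n} {k} k≤n =
  trans (cong (ℕ._* (k ! ℕ.* (n ∸ k) !)) (nCk≡n!/k![n-k]! k≤n)) (m/n*n≡m (k![n∸k]!∣n! k≤n))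
  where instance _ = k ℕ.!* (n ∸ k) !≢0

[1+k]*[1+n]C[1+k]≡[1+n]*nCk : ∀ n k → suc k ℕ.* (suc n C suc k) ≡ suc n ℕ.* (n C k)
[1+k]*[1+n]C[1+k]≡[1+n]*nCk n k with ℕ.≤-<-connex k n
... | inj₂ n<k = begin
  suc k ℕ.* (suc n C suc k) ≡⟨ cong (suc k ℕ.*_) (k>n⇒nCk≡0 (s≤s n<k)) ⟩
  suc k ℕ.* 0               ≡⟨ ℕ.*-zeroʳ (suc k) ⟩
  0                         ≡⟨ ℕ.*-zeroʳ (suc n) ⟨
  suc n ℕ.* 0               ≡⟨ cong (suc n ℕ.*_) (k>n⇒nCk≡0 n<k) ⟨
  suc n ℕ.* (n C k)         ∎
  where open ≡-Reasoning
... | inj₁ k≤n = ℕ.*-cancelʳ-≡ _ _ (k ! ℕ.* (n ∸ k) !) {{k ℕ.!* (n ∸ k) !≢0}} (begin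
  suc k ℕ.* C' ℕ.* (k ! ℕ.* (n ∸ k) !)   ≡⟨ rearrange (suc k) C' (k !) ((n ∸ k) !) ⟩
  C' ℕ.* (suc k ! ℕ.* (n ∸ k) !)        ≡⟨ nCk*[k!*[n∸k]!]≡n! (s≤s k≤n) ⟩
  suc n ℕ.* n !                          ≡⟨ cong (suc n ℕ.*_) (nCk*[k!*[n∸k]!]≡n! k≤n) ⟨
  suc n ℕ.* ((n C k) ℕ.* (k ! ℕ.* (n ∸ k) !)) ≡⟨ ℕ.*-assoc (suc n) (n C k) (k ! ℕ.* (n ∸ k) !) ⟨
  suc n ℕ.* (n C k) ℕ.* (k ! ℕ.* (n ∸ k) !) ∎)
  where
  open ≡-Reasoning
  C' = suc n C suc k
  rearrange : ∀ a b c d → a ℕ.* b ℕ.* (c ℕ.* d) ≡ b ℕ.* (a ℕ.* c ℕ.* d)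
  rearrange = solve-∀

stirling[1+n]1≡n! : ∀ n → stirling (suc n) 1 ≡ n !
stirling[1+n]1≡n! zero    = refl
stirling[1+n]1≡n! (suc n) = cong (suc n ℕ.*_) (stirling[1+n]1≡n! n)

module IntegerCoefficientSolver
  {A : Set} {add mul : A → A → A} {neg : A → A} {zer one : A}
  (isCommutativeRing : IsCommutativeRing _≡_ add mul neg zer one) where

  private
    R : CommutativeRing _ _
    R = record { isCommutativeRing = isCommutativeRing }
    open CommutativeRing R
      using (_+_; _*_; -_; 0#; 1#; +-assoc; +-comm; +-identityˡ; +-identityʳ; *-identityˡ; *-identityʳ;
             -‿inverseʳ; distribʳ; zeroˡ; zeroʳ; +-abelianGroup; +-commutativeSemigroup; *-commutativeSemigroup)
    open RingProperties (CommutativeRing.ring R) using (-‿involutive; -0#≈0#; -‿distribˡ-*)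
    open AbelianGroupProperties +-abelianGroup using (⁻¹-∙-comm)
    open CommutativeSemigroupProperties +-commutativeSemigroup using (interchange; x∙yz≈y∙xz)
    open CommutativeSemigroupProperties *-commutativeSemigroup using () renaming (interchange to *-interchange)
    open ≡-Reasoning

  -- 1 is sent to 1# on the nose, so that the constant 1 of a solver
  -- expression denotes 1# definitionally.
  ℕ→A : ℕ → A
  ℕ→A zero          = 0#
  ℕ→A (suc zero)    = 1#
  ℕ→A (suc (suc n)) = 1# + ℕ→A (suc n)

  ℕ→A-suc : ∀ n → ℕ→A (suc n) ≡ 1# + ℕ→A n
  ℕ→A-suc zero    = sym (+-identityʳ 1#)
  ℕ→A-suc (suc n) = refl

  ℕ→A-+ : ∀ m n → ℕ→A (m ℕ.+ n) ≡ ℕ→A m + ℕ→A n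
  ℕ→A-+ zero    n = sym (+-identityˡ _)
  ℕ→A-+ (suc m) n = begin
    ℕ→A (suc (m ℕ.+ n))     ≡⟨ ℕ→A-suc (m ℕ.+ n) ⟩
    1# + ℕ→A (m ℕ.+ n)      ≡⟨ cong (1# +_) (ℕ→A-+ m n) ⟩
    1# + (ℕ→A m + ℕ→A n)    ≡⟨ +-assoc 1# (ℕ→A m) (ℕ→A n) ⟨
    (1# + ℕ→A m) + ℕ→A n    ≡⟨ cong (_+ ℕ→A n) (ℕ→A-suc m) ⟨
    ℕ→A (suc m) + ℕ→A n     ∎

  ℕ→A-* : ∀ m n → ℕ→A (m ℕ.* n) ≡ ℕ→A m * ℕ→A n
  ℕ→A-* zero    n = sym (zeroˡ _)
  ℕ→A-* (suc m) n = begin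
    ℕ→A (n ℕ.+ m ℕ.* n)          ≡⟨ ℕ→A-+ n (m ℕ.* n) ⟩
    ℕ→A n + ℕ→A (m ℕ.* n)        ≡⟨ cong₂ _+_ (sym (*-identityˡ _)) (ℕ→A-* m n) ⟩
    1# * ℕ→A n + ℕ→A m * ℕ→A n   ≡⟨ distribʳ (ℕ→A n) 1# (ℕ→A m) ⟨
    (1# + ℕ→A m) * ℕ→A n         ≡⟨ cong (_* ℕ→A n) (ℕ→A-suc m) ⟨
    ℕ→A (suc m) * ℕ→A n          ∎

  ℤ→A : ℤ → A
  ℤ→A (ℤ.+ n)    = ℕ→A n
  ℤ→A -[1+ n ] = - ℕ→A (suc n)

  ℤ→A-⊖ : ∀ m n → ℤ→A (m ⊖ n) ≡ ℕ→A m + - ℕ→A n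
  ℤ→A-⊖ zero    zero    = sym (-‿inverseʳ 0#)
  ℤ→A-⊖ zero    (suc n) = sym (+-identityˡ _)
  ℤ→A-⊖ (suc m) zero    = sym (trans (cong (ℕ→A (suc m) +_) -0#≈0#) (+-identityʳ _))
  ℤ→A-⊖ (suc m) (suc n) = begin
    ℤ→A (suc m ⊖ suc n)                  ≡⟨ cong ℤ→A (ℤ.[1+m]⊖[1+n]≡m⊖n m n) ⟩
    ℤ→A (m ⊖ n)                          ≡⟨ ℤ→A-⊖ m n ⟩
    ℕ→A m + - ℕ→A n                      ≡⟨ +-identityˡ _ ⟨
    0# + (ℕ→A m + - ℕ→A n)               ≡⟨ cong (_+ (ℕ→A m + - ℕ→A n)) (-‿inverseʳ 1#) ⟨
    (1# + - 1#) + (ℕ→A m + - ℕ→A n)      ≡⟨ interchange 1# (ℕ→A m) (- 1#) (- ℕ→A n) ⟨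
    (1# + ℕ→A m) + (- 1# + - ℕ→A n)      ≡⟨ cong₂ _+_ (sym (ℕ→A-suc m)) (⁻¹-∙-comm 1# (ℕ→A n)) ⟩
    ℕ→A (suc m) + - (1# + ℕ→A n)         ≡⟨ cong (λ t → ℕ→A (suc m) + - t) (ℕ→A-suc n) ⟨
    ℕ→A (suc m) + - ℕ→A (suc n)          ∎

  ℤ→A-- : ∀ i → ℤ→A (ℤ.- i) ≡ - ℤ→A i
  ℤ→A-- (ℤ.+ zero)    = sym -0#≈0#
  ℤ→A-- (ℤ.+ suc n)   = refl
  ℤ→A-- -[1+ n ]    = sym (-‿involutive _)

  ℤ→A-+ : ∀ i j → ℤ→A (i ℤ.+ j) ≡ ℤ→A i + ℤ→A j
  ℤ→A-+ -[1+ m ] -[1+ n ] = begin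
    - ℕ→A (suc (suc (m ℕ.+ n)))           ≡⟨ cong -_ (ℕ→A-suc (suc (m ℕ.+ n))) ⟩
    - (1# + ℕ→A (suc m ℕ.+ n))            ≡⟨ cong (λ t → - (1# + t)) (ℕ→A-+ (suc m) n) ⟩
    - (1# + (ℕ→A (suc m) + ℕ→A n))        ≡⟨ cong -_ (x∙yz≈y∙xz 1# (ℕ→A (suc m)) (ℕ→A n)) ⟩
    - (ℕ→A (suc m) + (1# + ℕ→A n))        ≡⟨ cong (λ t → - (ℕ→A (suc m) + t)) (ℕ→A-suc n) ⟨
    - (ℕ→A (suc m) + ℕ→A (suc n))         ≡⟨ ⁻¹-∙-comm (ℕ→A (suc m)) (ℕ→A (suc n)) ⟨
    - ℕ→A (suc m) + - ℕ→A (suc n)         ∎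
  ℤ→A-+ -[1+ m ] (ℤ.+ n)    = trans (ℤ→A-⊖ n (suc m)) (+-comm _ _)
  ℤ→A-+ (ℤ.+ m)    -[1+ n ] = ℤ→A-⊖ m (suc n)
  ℤ→A-+ (ℤ.+ m)    (ℤ.+ n)    = ℕ→A-+ m n

  private
    Sign→A : Sign → A
    Sign→A Sign.+ = 1#
    Sign→A Sign.- = - 1#

    ℤ→A-◃ : ∀ s n → ℤ→A (s ◃ n) ≡ Sign→A s * ℕ→A n
    ℤ→A-◃ Sign.- zero    = sym (zeroʳ _)
    ℤ→A-◃ Sign.+ zero    = sym (zeroʳ _)
    ℤ→A-◃ Sign.- (suc n) = trans (cong -_ (sym (*-identityˡ _))) (-‿distribˡ-* 1# _)
    ℤ→A-◃ Sign.+ (suc n) = sym (*-identityˡ _)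

    Sign→A-* : ∀ s t → Sign→A (s Sign.* t) ≡ Sign→A s * Sign→A t
    Sign→A-* Sign.- Sign.- = begin
      1#                 ≡⟨ -‿involutive 1# ⟨
      - (- 1#)           ≡⟨ cong -_ (*-identityˡ (- 1#)) ⟨
      - (1# * - 1#)      ≡⟨ -‿distribˡ-* 1# (- 1#) ⟩
      - 1# * - 1#        ∎
    Sign→A-* Sign.- Sign.+ = sym (*-identityʳ _)
    Sign→A-* Sign.+ t      = sym (*-identityˡ _)

    ℤ→A-sign◃abs : ∀ i → ℤ→A i ≡ Sign→A (sign i) * ℕ→A ∣ i ∣
    ℤ→A-sign◃abs i = trans (cong ℤ→A (sym (ℤ.◃-inverse i))) (ℤ→A-◃ (sign i) ∣ i ∣)

  ℤ→A-* : ∀ i j → ℤ→A (i ℤ.* j) ≡ ℤ→A i * ℤ→A j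
  ℤ→A-* i j = begin
    ℤ→A ((sign i Sign.* sign j) ◃ (∣ i ∣ ℕ.* ∣ j ∣)) ≡⟨ ℤ→A-◃ (sign i Sign.* sign j) (∣ i ∣ ℕ.* ∣ j ∣) ⟩
    Sign→A (sign i Sign.* sign j) * ℕ→A (∣ i ∣ ℕ.* ∣ j ∣)
      ≡⟨ cong₂ _*_ (Sign→A-* (sign i) (sign j)) (ℕ→A-* ∣ i ∣ ∣ j ∣) ⟩
    (Sign→A (sign i) * Sign→A (sign j)) * (ℕ→A ∣ i ∣ * ℕ→A ∣ j ∣)
      ≡⟨ *-interchange (Sign→A (sign i)) (Sign→A (sign j)) (ℕ→A ∣ i ∣) (ℕ→A ∣ j ∣) ⟩
    (Sign→A (sign i) * ℕ→A ∣ i ∣) * (Sign→A (sign j) * ℕ→A ∣ j ∣)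
      ≡⟨ cong₂ _*_ (ℤ→A-sign◃abs i) (ℤ→A-sign◃abs j) ⟨
    ℤ→A i * ℤ→A j ∎

  private
    ℤ→A-homomorphism : ℤ.+-*-rawRing -Raw-AlmostCommutative⟶ fromCommutativeRing R
    ℤ→A-homomorphism = record
      { ⟦_⟧    = ℤ→A
      ; +-homo = ℤ→A-+
      ; *-homo = ℤ→A-*
      ; -‿homo = ℤ→A--
      ; 0-homo = refl
      ; 1-homo = refl
      }

    ℤ→A-≟ : ∀ i j → Maybe (ℤ→A i ≡ ℤ→A j)
    ℤ→A-≟ i j with i ℤ.≟ j
    ... | yes refl = just refl
    ... | no _     = nothing

  open Algebra.Solver.Ring ℤ.+-*-rawRing (fromCommutativeRing R) ℤ→A-homomorphism ℤ→A-≟ public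

  0ₚ 1ₚ : ∀ {n} → Polynomial n
  0ₚ = con (ℤ.+ 0)
  1ₚ = con (ℤ.+ 1)

module Lemmas (𝔽 : OrderedField) where

  open OF 𝔽 public
  open IntegerCoefficientSolver isCommutativeRing using (solve; _:+_; _:*_; :-_; _:-_; _:=_; 0ₚ; 1ₚ)

  private
    R : CommutativeRing _ _
    R = record { isCommutativeRing = isCommutativeRing }

  open CommutativeRing R
    using (+-assoc; +-comm; *-assoc; *-comm; +-identityˡ; +-identityʳ; *-identityˡ; *-identityʳ;
           distribˡ; distribʳ; zeroˡ; zeroʳ; -‿inverseʳ)
  open IsTotalOrder isTotalOrder using (total; antisym) renaming (refl to ≤-refl; trans to ≤-trans)
  open ≡-Reasoning

  inverseˡ : ∀ a → ¬ (a ≡ 0#) → a ⁻¹ * a ≡ 1#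
  inverseˡ a a≢0 = trans (*-comm _ _) (inverseʳ a a≢0)

  *-cancelˡ : ∀ a {b c} → ¬ (a ≡ 0#) → a * b ≡ a * c → b ≡ c
  *-cancelˡ a {b} {c} a≢0 ab≡ac = begin
    b                ≡⟨ *-identityˡ b ⟨
    1# * b           ≡⟨ cong (_* b) (inverseˡ a a≢0) ⟨
    (a ⁻¹ * a) * b   ≡⟨ *-assoc _ _ _ ⟩
    a ⁻¹ * (a * b)   ≡⟨ cong (a ⁻¹ *_) ab≡ac ⟩
    a ⁻¹ * (a * c)   ≡⟨ *-assoc _ _ _ ⟨
    (a ⁻¹ * a) * c   ≡⟨ cong (_* c) (inverseˡ a a≢0) ⟩
    1# * c           ≡⟨ *-identityˡ c ⟩
    c                ∎

  ⁻¹-unique : ∀ a b → ¬ (a ≡ 0#) → a * b ≡ 1# → b ≡ a ⁻¹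
  ⁻¹-unique a b a≢0 ab≡1 = *-cancelˡ a a≢0 (trans ab≡1 (sym (inverseʳ a a≢0)))

  *-≢0 : ∀ {a b} → ¬ (a ≡ 0#) → ¬ (b ≡ 0#) → ¬ (a * b ≡ 0#)
  *-≢0 {a} {b} a≢0 b≢0 ab≡0 = b≢0 (*-cancelˡ a a≢0 (trans ab≡0 (sym (zeroʳ a))))

  ⁻¹-distrib-* : ∀ a b → ¬ (a ≡ 0#) → ¬ (b ≡ 0#) → (a * b) ⁻¹ ≡ a ⁻¹ * b ⁻¹
  ⁻¹-distrib-* a b a≢0 b≢0 = sym (⁻¹-unique (a * b) (a ⁻¹ * b ⁻¹) (*-≢0 a≢0 b≢0) (begin
    (a * b) * (a ⁻¹ * b ⁻¹)    ≡⟨ solve 4 (λ a b a' b' → (a :* b) :* (a' :* b') := (a :* a') :* (b :* b')) refl a b (a ⁻¹) (b ⁻¹) ⟩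
    (a * a ⁻¹) * (b * b ⁻¹)    ≡⟨ cong₂ _*_ (inverseʳ a a≢0) (inverseʳ b b≢0) ⟩
    1# * 1#                    ≡⟨ *-identityˡ 1# ⟩
    1#                         ∎))

  1⁻¹≡1 : 1# ⁻¹ ≡ 1#
  1⁻¹≡1 = sym (⁻¹-unique 1# 1# (λ 1≡0 → 0≢1 (sym 1≡0)) (*-identityˡ 1#))

  0≤1 : 0# ≤ 1#
  0≤1 with total 0# 1#
  ... | inj₁ 0≤1 = 0≤1
  ... | inj₂ 1≤0 = ⊥-elim (0≢1 (antisym 0≤1′ 1≤0))
    where
    0≤-1 : 0# ≤ - 1#
    0≤-1 = subst₂ _≤_ (-‿inverseʳ 1#) (+-identityˡ (- 1#)) (+-mono-≤ (- 1#) 1≤0)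
    0≤1′ : 0# ≤ 1#
    0≤1′ = subst (0# ≤_) (solve 0 (:- 1ₚ :* :- 1ₚ := 1ₚ) refl) (*-nonneg 0≤-1 0≤-1)

  1≤1+fromℕ : ∀ n → 1# ≤ 1# + fromℕ n
  0≤fromℕ : ∀ n → 0# ≤ fromℕ n
  1≤1+fromℕ n = subst₂ _≤_ (+-identityˡ 1#) (+-comm (fromℕ n) 1#) (+-mono-≤ 1# (0≤fromℕ n))
  0≤fromℕ zero    = ≤-refl
  0≤fromℕ (suc n) = ≤-trans 0≤1 (1≤1+fromℕ n)

  fromℕ-suc≢0 : ∀ n → ¬ (fromℕ (suc n) ≡ 0#)
  fromℕ-suc≢0 n 1+n≡0 = 0≢1 (antisym 0≤1 (subst (1# ≤_) 1+n≡0 (1≤1+fromℕ n)))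

  fromℕ-+ : ∀ m n → fromℕ (m ℕ.+ n) ≡ fromℕ m + fromℕ n
  fromℕ-+ zero    n = sym (+-identityˡ _)
  fromℕ-+ (suc m) n = trans (cong (1# +_) (fromℕ-+ m n)) (sym (+-assoc _ _ _))

  fromℕ-* : ∀ m n → fromℕ (m ℕ.* n) ≡ fromℕ m * fromℕ n
  fromℕ-* zero    n = sym (zeroˡ _)
  fromℕ-* (suc m) n = begin
    fromℕ (n ℕ.+ m ℕ.* n)             ≡⟨ fromℕ-+ n (m ℕ.* n) ⟩
    fromℕ n + fromℕ (m ℕ.* n)         ≡⟨ cong₂ _+_ (sym (*-identityˡ _)) (fromℕ-* m n) ⟩
    1# * fromℕ n + fromℕ m * fromℕ n  ≡⟨ distribʳ _ _ _ ⟨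
    (1# + fromℕ m) * fromℕ n          ∎

  fromℕ-1 : fromℕ 1 ≡ 1#
  fromℕ-1 = +-identityʳ 1#

  fromℕ-!≢0 : ∀ n → ¬ (fromℕ (n !) ≡ 0#)
  fromℕ-!≢0 zero    = fromℕ-suc≢0 0
  fromℕ-!≢0 (suc n) n!≡0 = *-≢0 (fromℕ-suc≢0 n) (fromℕ-!≢0 n) (trans (sym (fromℕ-* (suc n) (n !))) n!≡0)

  recip : ℕ → F
  recip n = fromℕ n ⁻¹

  recip-inverseʳ : ∀ n → fromℕ (suc n) * recip (suc n) ≡ 1#
  recip-inverseʳ n = inverseʳ _ (fromℕ-suc≢0 n)

  ^-+ : ∀ a m n → a ^ (m ℕ.+ n) ≡ a ^ m * a ^ n
  ^-+ a zero    n = sym (*-identityˡ _)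
  ^-+ a (suc m) n = trans (cong (a *_) (^-+ a m n)) (sym (*-assoc _ _ _))

  ^-∸ : ∀ a {m n} → n ℕ.≤ m → a ^ m ≡ a ^ (m ∸ n) * a ^ n
  ^-∸ a {m} {n} n≤m = trans (cong (a ^_) (sym (ℕ.m∸n+n≡m n≤m))) (^-+ a (m ∸ n) n)

  ^-distribʳ-* : ∀ a b n → (a * b) ^ n ≡ a ^ n * b ^ n
  ^-distribʳ-* a b zero    = sym (*-identityˡ _)
  ^-distribʳ-* a b (suc n) = trans (cong ((a * b) *_) (^-distribʳ-* a b n))
    (solve 4 (λ a b c d → (a :* b) :* (c :* d) := (a :* c) :* (b :* d)) refl a b (a ^ n) (b ^ n))

  1^n≡1 : ∀ n → 1# ^ n ≡ 1#
  1^n≡1 zero    = refl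
  1^n≡1 (suc n) = trans (*-identityˡ _) (1^n≡1 n)

  ^-≢0 : ∀ {a} n → ¬ (a ≡ 0#) → ¬ (a ^ n ≡ 0#)
  ^-≢0 zero    a≢0 1≡0 = 0≢1 (sym 1≡0)
  ^-≢0 (suc n) a≢0     = *-≢0 a≢0 (^-≢0 n a≢0)

  ⁻¹-^ : ∀ a n → ¬ (a ≡ 0#) → (a ^ n) ⁻¹ ≡ (a ⁻¹) ^ n
  ⁻¹-^ a zero    a≢0 = 1⁻¹≡1
  ⁻¹-^ a (suc n) a≢0 = trans (⁻¹-distrib-* a (a ^ n) a≢0 (^-≢0 n a≢0)) (cong (a ⁻¹ *_) (⁻¹-^ a n a≢0))

  invPow≡recip^ : ∀ j k → invPow (suc j) k ≡ recip (suc j) ^ k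
  invPow≡recip^ j k = ⁻¹-^ (fromℕ (suc j)) k (fromℕ-suc≢0 j)

  sum0-cong : ∀ n {f g : ℕ → F} → (∀ i → i ℕ.≤ n → f i ≡ g i) → sum0 n f ≡ sum0 n g
  sum0-cong zero    f≗g = f≗g 0 z≤n
  sum0-cong (suc n) f≗g = cong₂ _+_ (sum0-cong n (λ i i≤n → f≗g i (ℕ.m≤n⇒m≤1+n i≤n))) (f≗g (suc n) ℕ.≤-refl)

  sum1-cong : ∀ n {f g : ℕ → F} → (∀ i → 1 ℕ.≤ i → i ℕ.≤ n → f i ≡ g i) → sum1 n f ≡ sum1 n g
  sum1-cong zero    f≗g = refl
  sum1-cong (suc n) f≗g =
    cong₂ _+_ (sum1-cong n (λ i 1≤i i≤n → f≗g i 1≤i (ℕ.m≤n⇒m≤1+n i≤n))) (f≗g (suc n) (s≤s z≤n) ℕ.≤-refl)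

  private
    medial : ∀ a b c d → (a + b) + (c + d) ≡ (a + c) + (b + d)
    medial = solve 4 (λ a b c d → (a :+ b) :+ (c :+ d) := (a :+ c) :+ (b :+ d)) refl

  sum0-+ : ∀ n (f g : ℕ → F) → sum0 n (λ i → f i + g i) ≡ sum0 n f + sum0 n g
  sum0-+ zero    f g = refl
  sum0-+ (suc n) f g = trans (cong (_+ (f (suc n) + g (suc n))) (sum0-+ n f g)) (medial _ _ _ _)

  sum1-+ : ∀ n (f g : ℕ → F) → sum1 n (λ i → f i + g i) ≡ sum1 n f + sum1 n g
  sum1-+ zero    f g = sym (+-identityˡ _)
  sum1-+ (suc n) f g = trans (cong (_+ (f (suc n) + g (suc n))) (sum1-+ n f g)) (medial _ _ _ _)

  *-distribˡ-sum0 : ∀ n c (f : ℕ → F) → c * sum0 n f ≡ sum0 n (λ i → c * f i)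
  *-distribˡ-sum0 zero    c f = refl
  *-distribˡ-sum0 (suc n) c f = trans (distribˡ _ _ _) (cong (_+ c * f (suc n)) (*-distribˡ-sum0 n c f))

  *-distribˡ-sum1 : ∀ n c (f : ℕ → F) → c * sum1 n f ≡ sum1 n (λ i → c * f i)
  *-distribˡ-sum1 zero    c f = zeroʳ c
  *-distribˡ-sum1 (suc n) c f = trans (distribˡ _ _ _) (cong (_+ c * f (suc n)) (*-distribˡ-sum1 n c f))

  sum0-zero : ∀ n → sum0 n (λ _ → 0#) ≡ 0#
  sum0-zero zero    = refl
  sum0-zero (suc n) = trans (+-identityʳ _) (sum0-zero n)

  sum0-suc : ∀ n (f : ℕ → F) → sum0 (suc n) f ≡ f 0 + sum0 n (f ∘ suc)
  sum0-suc zero    f = refl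
  sum0-suc (suc n) f = trans (cong (_+ f (suc (suc n))) (sum0-suc n f)) (+-assoc _ _ _)

  sum0≡f0+sum1 : ∀ n (f : ℕ → F) → sum0 n f ≡ f 0 + sum1 n f
  sum0≡f0+sum1 zero    f = sym (+-identityʳ _)
  sum0≡f0+sum1 (suc n) f = trans (cong (_+ f (suc n)) (sum0≡f0+sum1 n f)) (+-assoc _ _ _)

  sum1-suc : ∀ n (f : ℕ → F) → sum1 (suc n) f ≡ sum0 n (f ∘ suc)
  sum1-suc zero    f = +-identityˡ _
  sum1-suc (suc n) f = cong (_+ f (suc (suc n))) (sum1-suc n f)

  sum0-convolution-last : ∀ k (Φ : ℕ → ℕ → F) →
    sum0 (suc k) (λ i → Φ i (suc k ∸ i)) ≡ sum0 k (λ i → Φ i (suc (k ∸ i))) + Φ (suc k) 0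
  sum0-convolution-last k Φ =
    cong₂ _+_ (sum0-cong k (λ i i≤k → cong (Φ i) (ℕ.+-∸-assoc 1 i≤k))) (cong (Φ (suc k)) (ℕ.n∸n≡0 k))

  cross-multiply : ∀ {a b c d} → ¬ (a ≡ 0#) → ¬ (b ≡ 0#) → a * d ≡ b * c → c * a ⁻¹ ≡ b ⁻¹ * d
  cross-multiply {a} {b} {c} {d} a≢0 b≢0 ad≡bc = begin
    c * a ⁻¹                    ≡⟨ *-identityˡ _ ⟨
    1# * (c * a ⁻¹)             ≡⟨ cong (_* (c * a ⁻¹)) (inverseˡ b b≢0) ⟨
    (b ⁻¹ * b) * (c * a ⁻¹)     ≡⟨ solve 4 (λ a' b b' c → (b' :* b) :* (c :* a') := b' :* (b :* c) :* a') refl (a ⁻¹) b (b ⁻¹) c ⟩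
    b ⁻¹ * (b * c) * a ⁻¹       ≡⟨ cong (λ t → b ⁻¹ * t * a ⁻¹) ad≡bc ⟨
    b ⁻¹ * (a * d) * a ⁻¹       ≡⟨ solve 4 (λ a a' b' d → b' :* (a :* d) :* a' := b' :* d :* (a :* a')) refl a (a ⁻¹) (b ⁻¹) d ⟩
    b ⁻¹ * d * (a * a ⁻¹)       ≡⟨ cong (b ⁻¹ * d *_) (inverseʳ a a≢0) ⟩
    b ⁻¹ * d * 1#               ≡⟨ *-identityʳ _ ⟩
    b ⁻¹ * d                    ∎

  nCk/[1+k]≡[1+n]C[1+k]/[1+n] : ∀ n k → fromℕ (n C k) * recip (suc k) ≡ recip (suc n) * fromℕ (suc n C suc k)
  nCk/[1+k]≡[1+n]C[1+k]/[1+n] n k = cross-multiply (fromℕ-suc≢0 k) (fromℕ-suc≢0 n) (begin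
    fromℕ (suc k) * fromℕ (suc n C suc k)   ≡⟨ fromℕ-* (suc k) (suc n C suc k) ⟨
    fromℕ (suc k ℕ.* (suc n C suc k))       ≡⟨ cong fromℕ ([1+k]*[1+n]C[1+k]≡[1+n]*nCk n k) ⟩
    fromℕ (suc n ℕ.* (n C k))               ≡⟨ fromℕ-* (suc n) (n C k) ⟩
    fromℕ (suc n) * fromℕ (n C k)           ∎)

  kCi*i!/k!≡1/[k∸i]! : ∀ k i → i ℕ.≤ k → fromℕ (k C i) * fromℕ (i !) * fromℕ (k !) ⁻¹ ≡ fromℕ ((k ∸ i) !) ⁻¹
  kCi*i!/k!≡1/[k∸i]! k i i≤k =
    trans (cross-multiply (fromℕ-!≢0 k) (fromℕ-!≢0 (k ∸ i)) k!*1≡[k∸i]!*[C*i!]) (*-identityʳ _)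
    where
    k!*1≡[k∸i]!*[C*i!] : fromℕ (k !) * 1# ≡ fromℕ ((k ∸ i) !) * (fromℕ (k C i) * fromℕ (i !))
    k!*1≡[k∸i]!*[C*i!] = begin
      fromℕ (k !) * 1#                                    ≡⟨ *-identityʳ _ ⟩
      fromℕ (k !)                                         ≡⟨ cong fromℕ (nCk*[k!*[n∸k]!]≡n! i≤k) ⟨
      fromℕ ((k C i) ℕ.* (i ! ℕ.* (k ∸ i) !))             ≡⟨ fromℕ-* (k C i) _ ⟩
      fromℕ (k C i) * fromℕ (i ! ℕ.* (k ∸ i) !)           ≡⟨ cong (fromℕ (k C i) *_) (fromℕ-* (i !) ((k ∸ i) !)) ⟩
      fromℕ (k C i) * (fromℕ (i !) * fromℕ ((k ∸ i) !))   ≡⟨ solve 3 (λ c f g → c :* (f :* g) := g :* (c :* f)) refl _ _ _ ⟩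
      fromℕ ((k ∸ i) !) * (fromℕ (k C i) * fromℕ (i !))   ∎

  1/[1+n]! : ∀ n → fromℕ (suc n !) ⁻¹ ≡ recip (suc n) * fromℕ (n !) ⁻¹
  1/[1+n]! n = trans (cong _⁻¹ (fromℕ-* (suc n) (n !))) (⁻¹-distrib-* _ _ (fromℕ-suc≢0 n) (fromℕ-!≢0 n))

  -- Symmetric functions of 1, 1/2, …, 1/a

  -- h_k(1, 1/2, …, 1/a), through the recurrence obtained by splitting off 1/(a+1)
  complete : ℕ → ℕ → F
  complete a       zero    = 1#
  complete zero    (suc k) = 0#
  complete (suc a) (suc k) = complete a (suc k) + recip (suc a) * complete (suc a) k

  -- The right-hand side of Newton's identity (k+1) g_{k+1} = Σ_{i ≤ k} p_{i+1} g_{k-i}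
  -- for the power sums p_r = H_a^{(r)}.
  newtonSum : ℕ → (ℕ → F) → ℕ → F
  newtonSum a g k = sum0 k (λ i → H a (suc i) * g (k ∸ i))

  newtonSum-+ : ∀ a f g k → newtonSum a (λ t → f t + g t) k ≡ newtonSum a f k + newtonSum a g k
  newtonSum-+ a f g k = trans (sum0-cong k (λ i _ → distribˡ _ _ _)) (sum0-+ k _ _)

  H-suc : ∀ a r → H (suc a) r ≡ H a r + recip (suc a) ^ r
  H-suc a r = cong (H a r +_) (invPow≡recip^ a r)

  complete-newton : ∀ a k → fromℕ (suc k) * complete a (suc k) ≡ newtonSum a (complete a) k
  complete-newton zero    k = trans (zeroʳ _) (sym (trans (sum0-cong k (λ i _ → zeroˡ _)) (sum0-zero k)))
  complete-newton (suc a) = newton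
    where
    e  = recip (suc a)
    h  = complete a
    h′ = complete (suc a)

    δ : ℕ → F
    δ zero    = 0#
    δ (suc t) = e * h′ t

    h′≡h+δ : ∀ t → h′ t ≡ h t + δ t
    h′≡h+δ zero    = sym (+-identityʳ _)
    h′≡h+δ (suc t) = refl

    geometric : ℕ → F
    geometric k = sum0 k (λ i → e ^ suc i * h′ (k ∸ i))

    newtonSum-suc : ∀ k → newtonSum (suc a) h′ k ≡ newtonSum a h′ k + geometric k
    newtonSum-suc k = trans (sum0-cong k (λ i _ → trans (cong (_* h′ (k ∸ i)) (H-suc a (suc i))) (distribʳ _ _ _)))
                            (sum0-+ k _ _)

    newtonSum-h′ : ∀ k → newtonSum a h′ k ≡ newtonSum a h k + newtonSum a δ k
    newtonSum-h′ k = trans (sum0-cong k (λ i _ → cong (H a (suc i) *_) (h′≡h+δ (k ∸ i)))) (newtonSum-+ a h δ k)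

    newtonSum-δ : ∀ k → newtonSum a δ (suc k) ≡ e * newtonSum a h′ k
    newtonSum-δ k = begin
      newtonSum a δ (suc k)                                       ≡⟨ sum0-convolution-last k (λ i t → H a (suc i) * δ t) ⟩
      sum0 k (λ i → H a (suc i) * (e * h′ (k ∸ i))) + H a (suc (suc k)) * 0#
        ≡⟨ cong₂ _+_ (sum0-cong k (λ i _ → solve 3 (λ p e g → p :* (e :* g) := e :* (p :* g)) refl _ _ _)) (zeroʳ _) ⟩
      sum0 k (λ i → e * (H a (suc i) * h′ (k ∸ i))) + 0#          ≡⟨ +-identityʳ _ ⟩
      sum0 k (λ i → e * (H a (suc i) * h′ (k ∸ i)))               ≡⟨ *-distribˡ-sum0 k e _ ⟨
      e * newtonSum a h′ k                                        ∎

    geometric-suc : ∀ k → geometric (suc k) ≡ e * h′ (suc k) + e * geometric k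
    geometric-suc k = trans (sum0-suc k _) (cong₂ _+_ (cong (_* h′ (suc k)) (*-identityʳ e))
      (trans (sum0-cong k (λ i _ → *-assoc _ _ _)) (sym (*-distribˡ-sum0 k e _))))

    newton : ∀ k → fromℕ (suc k) * h′ (suc k) ≡ newtonSum (suc a) h′ k
    newton zero = begin
      fromℕ 1 * (h 1 + e * 1#)             ≡⟨ distribˡ _ _ _ ⟩
      fromℕ 1 * h 1 + fromℕ 1 * (e * 1#)   ≡⟨ cong₂ _+_ (complete-newton a 0) (trans (cong (_* (e * 1#)) fromℕ-1) (*-identityˡ _)) ⟩
      H a 1 * 1# + e ^ 1                   ≡⟨ solve 2 (λ p q → p :* 1ₚ :+ q := (p :+ q) :* 1ₚ) refl _ _ ⟩
      (H a 1 + e ^ 1) * 1#                 ≡⟨ cong (_* 1#) (H-suc a 1) ⟨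
      H (suc a) 1 * 1#                     ∎
    newton (suc k) = begin
      (1# + K) * (h (suc (suc k)) + e * h′ (suc k))
        ≡⟨ solve 4 (λ K h e g → (1ₚ :+ K) :* (h :+ e :* g) := (1ₚ :+ K) :* h :+ e :* (K :* g) :+ e :* g) refl K _ e _ ⟩
      (1# + K) * h (suc (suc k)) + e * (K * h′ (suc k)) + e * h′ (suc k)
        ≡⟨ cong (λ t → (1# + K) * h (suc (suc k)) + e * t + e * h′ (suc k)) (trans (newton k) (newtonSum-suc k)) ⟩
      (1# + K) * h (suc (suc k)) + e * (newtonSum a h′ k + geometric k) + e * h′ (suc k)
        ≡⟨ solve 5 (λ A e s g h → A :+ e :* (s :+ g) :+ e :* h := (A :+ e :* s) :+ (e :* h :+ e :* g)) refl _ e _ _ _ ⟩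
      ((1# + K) * h (suc (suc k)) + e * newtonSum a h′ k) + (e * h′ (suc k) + e * geometric k)
        ≡⟨ cong₂ _+_ (cong₂ _+_ (complete-newton a (suc k)) (sym (newtonSum-δ k))) (sym (geometric-suc k)) ⟩
      (newtonSum a h (suc k) + newtonSum a δ (suc k)) + geometric (suc k)
        ≡⟨ cong (_+ geometric (suc k)) (newtonSum-h′ (suc k)) ⟨
      newtonSum a h′ (suc k) + geometric (suc k)
        ≡⟨ newtonSum-suc (suc k) ⟨
      newtonSum (suc a) h′ (suc k) ∎
      where K = fromℕ (suc k)

  newton-unique : ∀ a (g g′ : ℕ → F) → g 0 ≡ g′ 0 →
                  (∀ k → fromℕ (suc k) * g (suc k) ≡ newtonSum a g k) →
                  (∀ k → fromℕ (suc k) * g′ (suc k) ≡ newtonSum a g′ k) →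
                  ∀ k → g k ≡ g′ k
  newton-unique a g g′ g0≡g′0 newton newton′ k = bounded k k ℕ.≤-refl
    where
    bounded : ∀ bound t → t ℕ.≤ bound → g t ≡ g′ t
    bounded _           zero    _         = g0≡g′0
    bounded (suc bound) (suc t) (s≤s t≤b) = *-cancelˡ (fromℕ (suc t)) (fromℕ-suc≢0 t) (begin
      fromℕ (suc t) * g (suc t)     ≡⟨ newton t ⟩
      newtonSum a g t               ≡⟨ sum0-cong t (λ i _ → cong (H a (suc i) *_)
                                         (bounded bound (t ∸ i) (ℕ.≤-trans (ℕ.m∸n≤m t i) t≤b))) ⟩
      newtonSum a g′ t              ≡⟨ newton′ t ⟨
      fromℕ (suc t) * g′ (suc t)    ∎)

  YF-fuel : ∀ n f f′ k → k ℕ.≤ f → k ℕ.≤ f′ → YF n f k ≡ YF n f′ k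
  YF-fuel n f       f′       zero    _         _          = refl
  YF-fuel n (suc f) (suc f′) (suc k) (s≤s k≤f) (s≤s k≤f′) = sum0-cong k (λ i _ →
    cong (fromℕ (k C i) * (fromℕ (i !) * H n (suc i)) *_)
      (YF-fuel n f f′ (k ∸ i) (ℕ.≤-trans (ℕ.m∸n≤m k i) k≤f) (ℕ.≤-trans (ℕ.m∸n≤m k i) k≤f′)))

  Y-suc : ∀ k n → Y (suc k) n ≡ sum0 k (λ i → fromℕ (k C i) * (fromℕ (i !) * H n (suc i)) * Y (k ∸ i) n)
  Y-suc k n = sum0-cong k (λ i _ → cong (fromℕ (k C i) * (fromℕ (i !) * H n (suc i)) *_)
    (YF-fuel n k (k ∸ i) (k ∸ i) (ℕ.m∸n≤m k i) ℕ.≤-refl))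

  Y/!-newton : ∀ a k → fromℕ (suc k) * (Y (suc k) a * fromℕ (suc k !) ⁻¹)
                       ≡ newtonSum a (λ i → Y i a * fromℕ (i !) ⁻¹) k
  Y/!-newton a k = begin
    K * (Y (suc k) a * fromℕ (suc k !) ⁻¹)           ≡⟨ cong (λ t → K * (Y (suc k) a * t)) (1/[1+n]! k) ⟩
    K * (Y (suc k) a * (recip (suc k) * k!⁻¹))       ≡⟨ solve 4 (λ K y r f → K :* (y :* (r :* f)) := (K :* r) :* (f :* y)) refl K _ _ k!⁻¹ ⟩
    (K * recip (suc k)) * (k!⁻¹ * Y (suc k) a)       ≡⟨ cong₂ _*_ (recip-inverseʳ k) (cong (k!⁻¹ *_) (Y-suc k a)) ⟩
    1# * (k!⁻¹ * sum0 k _)                           ≡⟨ *-identityˡ _ ⟩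
    k!⁻¹ * sum0 k _                                  ≡⟨ *-distribˡ-sum0 k k!⁻¹ _ ⟩
    sum0 k _                                         ≡⟨ sum0-cong k term ⟩
    newtonSum a (λ i → Y i a * fromℕ (i !) ⁻¹) k     ∎
    where
    K    = fromℕ (suc k)
    k!⁻¹ = fromℕ (k !) ⁻¹
    term : ∀ i → i ℕ.≤ k → k!⁻¹ * (fromℕ (k C i) * (fromℕ (i !) * H a (suc i)) * Y (k ∸ i) a)
                           ≡ H a (suc i) * (Y (k ∸ i) a * fromℕ ((k ∸ i) !) ⁻¹)
    term i i≤k = begin
      k!⁻¹ * (fromℕ (k C i) * (fromℕ (i !) * H a (suc i)) * Y (k ∸ i) a)
        ≡⟨ solve 5 (λ f c g p y → f :* (c :* (g :* p) :* y) := p :* (y :* (c :* g :* f))) refl k!⁻¹ _ _ _ _ ⟩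
      H a (suc i) * (Y (k ∸ i) a * (fromℕ (k C i) * fromℕ (i !) * k!⁻¹))
        ≡⟨ cong (λ t → H a (suc i) * (Y (k ∸ i) a * t)) (kCi*i!/k!≡1/[k∸i]! k i i≤k) ⟩
      H a (suc i) * (Y (k ∸ i) a * fromℕ ((k ∸ i) !) ⁻¹) ∎

  Y/!≡complete : ∀ a k → Y k a * fromℕ (k !) ⁻¹ ≡ complete a k
  Y/!≡complete a = newton-unique a _ (complete a)
    (trans (*-identityˡ _) (trans (cong _⁻¹ fromℕ-1) 1⁻¹≡1)) (Y/!-newton a) (complete-newton a)

  -- s(b+1, t+1)/b! = e_t(1, 1/2, …, 1/b)
  elementary : ℕ → ℕ → F
  elementary b t = fromℕ (stirling (suc b) (suc t)) * fromℕ (b !) ⁻¹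

  elementary-zero : ∀ b → elementary b 0 ≡ 1#
  elementary-zero b = trans (cong (λ s → fromℕ s * fromℕ (b !) ⁻¹) (stirling[1+n]1≡n! b)) (inverseʳ _ (fromℕ-!≢0 b))

  elementary-suc : ∀ b t → elementary (suc b) (suc t) ≡ elementary b (suc t) + recip (suc b) * elementary b t
  elementary-suc b t = begin
    fromℕ (S₁ ℕ.+ suc b ℕ.* S₂) * fromℕ (suc b !) ⁻¹
      ≡⟨ cong₂ _*_ (trans (fromℕ-+ S₁ _) (cong (fromℕ S₁ +_) (fromℕ-* (suc b) S₂))) (1/[1+n]! b) ⟩
    (fromℕ S₁ + B * fromℕ S₂) * (recip (suc b) * b!⁻¹)
      ≡⟨ solve 5 (λ s₁ B s₂ r f → (s₁ :+ B :* s₂) :* (r :* f) := (B :* r) :* (s₂ :* f) :+ r :* (s₁ :* f)) refl _ B _ _ b!⁻¹ ⟩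
    (B * recip (suc b)) * (fromℕ S₂ * b!⁻¹) + recip (suc b) * (fromℕ S₁ * b!⁻¹)
      ≡⟨ cong (λ u → u * (fromℕ S₂ * b!⁻¹) + recip (suc b) * (fromℕ S₁ * b!⁻¹)) (recip-inverseʳ b) ⟩
    1# * (fromℕ S₂ * b!⁻¹) + recip (suc b) * (fromℕ S₁ * b!⁻¹)
      ≡⟨ cong (_+ recip (suc b) * (fromℕ S₁ * b!⁻¹)) (*-identityˡ _) ⟩
    elementary b (suc t) + recip (suc b) * elementary b t ∎
    where
    S₁ = stirling (suc b) (suc t)
    S₂ = stirling (suc b) (suc (suc t))
    B = fromℕ (suc b)
    b!⁻¹ = fromℕ (b !) ⁻¹

  -- G a b k is the coefficient of tᵏ in Π_{i ≤ b} (1 + t/i) / Π_{i ≤ a} (1 + t/i).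
  G : ℕ → ℕ → ℕ → F
  G a b k = sum0 k (λ i → sgn i * complete a i * elementary b (k ∸ i))

  G-zero : ∀ a b → G a b 0 ≡ 1#
  G-zero a b = trans (cong (1# * 1# *_) (elementary-zero b)) (trans (*-identityʳ _) (*-identityʳ _))

  G-suc-left : ∀ a b k → G (suc a) b (suc k) ≡ G a b (suc k) + (- recip (suc a)) * G (suc a) b k
  G-suc-left a b k = begin
    G (suc a) b (suc k)
      ≡⟨ sum0-suc k _ ⟩
    1# * 1# * E (suc k) + sum0 k (λ i → sgn (suc i) * (h (suc i) + e * h′ i) * E (k ∸ i))
      ≡⟨ cong (1# * 1# * E (suc k) +_) (trans (sum0-cong k (λ i _ → split (sgn i) (h (suc i)) (h′ i) (E (k ∸ i))))
                                               (sum0-+ k _ _)) ⟩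
    1# * 1# * E (suc k) + (sum0 k (λ i → sgn (suc i) * h (suc i) * E (k ∸ i))
                           + sum0 k (λ i → (- e) * (sgn i * h′ i * E (k ∸ i))))
      ≡⟨ cong (λ t → 1# * 1# * E (suc k) + (sum0 k (λ i → sgn (suc i) * h (suc i) * E (k ∸ i)) + t))
              (*-distribˡ-sum0 k (- e) _) ⟨
    1# * 1# * E (suc k) + (sum0 k (λ i → sgn (suc i) * h (suc i) * E (k ∸ i)) + (- e) * G (suc a) b k)
      ≡⟨ +-assoc _ _ _ ⟨
    (1# * 1# * E (suc k) + sum0 k (λ i → sgn (suc i) * h (suc i) * E (k ∸ i))) + (- e) * G (suc a) b k
      ≡⟨ cong (_+ (- e) * G (suc a) b k) (sum0-suc k _) ⟨
    G a b (suc k) + (- e) * G (suc a) b k ∎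
    where
    e  = recip (suc a)
    h  = complete a
    h′ = complete (suc a)
    E  = elementary b
    split : ∀ s u v w → ((- 1#) * s) * (u + e * v) * w ≡ ((- 1#) * s) * u * w + (- e) * (s * v * w)
    split = solve 5 (λ e s u v w → (:- 1ₚ :* s) :* (u :+ e :* v) :* w := (:- 1ₚ :* s) :* u :* w :+ (:- e) :* (s :* v :* w)) refl e

  G-suc-right : ∀ a b k → G a (suc b) (suc k) ≡ G a b (suc k) + recip (suc b) * G a b k
  G-suc-right a b k = begin
    G a (suc b) (suc k)
      ≡⟨ sum0-convolution-last k (λ i t → sgn i * h i * elementary (suc b) t) ⟩
    sum0 k (λ i → sgn i * h i * elementary (suc b) (suc (k ∸ i))) + sgn (suc k) * h (suc k) * elementary (suc b) 0
      ≡⟨ cong₂ _+_ (sum0-cong k (λ i _ → trans (cong (sgn i * h i *_) (elementary-suc b (k ∸ i))) (distribˡ _ _ _)))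
                   (cong (sgn (suc k) * h (suc k) *_) (trans (elementary-zero (suc b)) (sym (elementary-zero b)))) ⟩
    sum0 k (λ i → sgn i * h i * E (suc (k ∸ i)) + sgn i * h i * (e * E (k ∸ i))) + last
      ≡⟨ cong (_+ last) (trans (sum0-+ k _ _) (cong (shifted +_) (trans
           (sum0-cong k (λ i _ → solve 4 (λ s u e w → s :* u :* (e :* w) := e :* (s :* u :* w)) refl _ _ e _))
           (sym (*-distribˡ-sum0 k e _))))) ⟩
    (shifted + e * G a b k) + last
      ≡⟨ solve 3 (λ x y z → (x :+ y) :+ z := (x :+ z) :+ y) refl shifted _ last ⟩
    (shifted + last) + e * G a b k
      ≡⟨ cong (_+ e * G a b k) (sum0-convolution-last k (λ i t → sgn i * h i * E t)) ⟨
    G a b (suc k) + e * G a b k ∎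
    where
    e    = recip (suc b)
    h    = complete a
    E    = elementary b
    last    = sgn (suc k) * h (suc k) * E 0
    shifted = sum0 k (λ i → sgn i * h i * E (suc (k ∸ i)))

  G-diagonal : ∀ a k → G a a (suc k) ≡ 0#
  G-diagonal zero k = begin
    G 0 0 (suc k)
      ≡⟨ sum0-suc k _ ⟩
    1# * 1# * elementary 0 (suc k) + sum0 k (λ i → sgn (suc i) * 0# * elementary 0 (k ∸ i))
      ≡⟨ cong₂ _+_ (trans (cong (1# * 1# *_) (zeroˡ _)) (zeroʳ _))
                   (trans (sum0-cong k (λ i _ → trans (cong (_* elementary 0 (k ∸ i)) (zeroʳ _)) (zeroˡ _)))
                                    (sum0-zero k)) ⟩
    0# + 0#
      ≡⟨ +-identityʳ 0# ⟩
    0# ∎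
  G-diagonal (suc a) k = begin
    G (suc a) (suc a) (suc k)                                   ≡⟨ G-suc-left a (suc a) k ⟩
    G a (suc a) (suc k) + (- e) * G (suc a) (suc a) k           ≡⟨ cong (_+ (- e) * G (suc a) (suc a) k) (G-suc-right a a k) ⟩
    (G a a (suc k) + e * G a a k) + (- e) * G (suc a) (suc a) k ≡⟨ cong₂ (λ u v → (u + e * G a a k) + (- e) * v)
                                                                          (G-diagonal a k) (G-diagonals-agree k) ⟩
    (0# + e * G a a k) + (- e) * G a a k                        ≡⟨ solve 2 (λ e g → (0ₚ :+ e :* g) :+ (:- e) :* g := 0ₚ) refl e _ ⟩
    0#                                                          ∎
    where
    e = recip (suc a)
    G-diagonals-agree : ∀ k → G (suc a) (suc a) k ≡ G a a k
    G-diagonals-agree zero    = trans (G-zero (suc a) (suc a)) (sym (G-zero a a))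
    G-diagonals-agree (suc k) = trans (G-diagonal (suc a) k) (sym (G-diagonal a k))

  -- solution w k f is the (k+1)-fold iterate of the operator sending f to the solution of
  -- g(n+1) = w g(n) + f(n+1)/(n+1), g(0) = 0 (see solution-suc); kernel is its matrix.
  kernel : F → ℕ → ℕ → ℕ → F
  kernel w k n j = w ^ (n ∸ j) * (recip j * (sgn k * G n (j ∸ 1) k))

  solution : F → ℕ → (ℕ → F) → ℕ → F
  solution w k f n = sum1 n (λ j → kernel w k n j * f j)

  ^[1+n∸j] : ∀ w {n j} → j ℕ.≤ n → w ^ (suc n ∸ j) ≡ w * w ^ (n ∸ j)
  ^[1+n∸j] w j≤n = cong (w ^_) (ℕ.+-∸-assoc 1 j≤n)

  ^[n∸n] : ∀ w n → w ^ (n ∸ n) ≡ 1#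
  ^[n∸n] w n = cong (w ^_) (ℕ.n∸n≡0 n)

  solution-zero-suc : ∀ w f n → solution w 0 f (suc n) ≡ w * solution w 0 f n + recip (suc n) * f (suc n)
  solution-zero-suc w f n = cong₂ _+_
    (trans (sum1-cong n (λ j _ j≤n → begin
        w ^ (suc n ∸ j) * (recip j * (1# * G (suc n) (j ∸ 1) 0)) * f j
          ≡⟨ cong₂ (λ u v → u * (recip j * (1# * v)) * f j) (^[1+n∸j] w j≤n)
                   (trans (G-zero (suc n) (j ∸ 1)) (sym (G-zero n (j ∸ 1)))) ⟩
        (w * w ^ (n ∸ j)) * (recip j * (1# * G n (j ∸ 1) 0)) * f j
          ≡⟨ solve 4 (λ w W A f → (w :* W) :* A :* f := w :* (W :* A :* f)) refl w _ _ (f j) ⟩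
        w * (kernel w 0 n j * f j) ∎))
      (sym (*-distribˡ-sum1 n w _)))
    (begin
      w ^ (suc n ∸ suc n) * (recip (suc n) * (1# * G (suc n) n 0)) * f (suc n)
        ≡⟨ cong₂ (λ u v → u * (recip (suc n) * (1# * v)) * f (suc n)) (^[n∸n] w n) (G-zero (suc n) n) ⟩
      1# * (recip (suc n) * (1# * 1#)) * f (suc n)
        ≡⟨ solve 2 (λ r f → 1ₚ :* (r :* (1ₚ :* 1ₚ)) :* f := r :* f) refl (recip (suc n)) (f (suc n)) ⟩
      recip (suc n) * f (suc n) ∎)

  solution-suc-suc : ∀ w k f n →
    solution w (suc k) f (suc n) ≡ w * solution w (suc k) f n + recip (suc n) * solution w k f (suc n)
  solution-suc-suc w k f n = begin
    sum1 n T + T (suc n)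
      ≡⟨ cong₂ _+_ (sum1-cong n T≡) T-last ⟩
    sum1 n (λ j → w * X j + c * Z j) + c * Z (suc n)
      ≡⟨ cong (_+ c * Z (suc n)) (trans (sum1-+ n _ _) (cong₂ _+_ (sym (*-distribˡ-sum1 n w X)) (sym (*-distribˡ-sum1 n c Z)))) ⟩
    (w * sum1 n X + c * sum1 n Z) + c * Z (suc n)
      ≡⟨ solve 4 (λ a b c d → (a :+ c :* b) :+ c :* d := a :+ c :* (b :+ d)) refl _ (sum1 n Z) c (Z (suc n)) ⟩
    w * sum1 n X + c * (sum1 n Z + Z (suc n)) ∎
    where
    c = recip (suc n)
    T X Z : ℕ → F
    T j = kernel w (suc k) (suc n) j * f j
    X j = kernel w (suc k) n j * f j
    Z j = kernel w k (suc n) j * f j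
    T≡ : ∀ j → 1 ℕ.≤ j → j ℕ.≤ n → T j ≡ w * X j + c * Z j
    T≡ (suc b) _ j≤n = begin
      w ^ (suc n ∸ suc b) * (recip (suc b) * (sgn (suc k) * G (suc n) b (suc k))) * f (suc b)
        ≡⟨ cong₂ (λ u v → u * (recip (suc b) * (sgn (suc k) * v)) * f (suc b)) (^[1+n∸j] w j≤n) (G-suc-left n b k) ⟩
      (w * W) * (r * ((- 1#) * sgn k * (G n b (suc k) + (- c) * G (suc n) b k))) * f (suc b)
        ≡⟨ solve 8 (λ w W r s A c B f → (w :* W) :* (r :* ((:- 1ₚ :* s) :* (A :+ (:- c) :* B))) :* f
                     := w :* (W :* (r :* ((:- 1ₚ :* s) :* A)) :* f) :+ c :* ((w :* W) :* (r :* (s :* B)) :* f))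
                 refl w W r (sgn k) _ c _ (f (suc b)) ⟩
      w * X (suc b) + c * ((w * W) * (r * (sgn k * G (suc n) b k)) * f (suc b))
        ≡⟨ cong (λ u → w * X (suc b) + c * (u * (r * (sgn k * G (suc n) b k)) * f (suc b))) (^[1+n∸j] w j≤n) ⟨
      w * X (suc b) + c * Z (suc b) ∎
      where
      W = w ^ (n ∸ suc b)
      r = recip (suc b)
    T-last : T (suc n) ≡ c * Z (suc n)
    T-last = begin
      w ^ (suc n ∸ suc n) * (c * (sgn (suc k) * G (suc n) n (suc k))) * f (suc n)
        ≡⟨ cong₂ (λ u v → u * (c * (sgn (suc k) * v)) * f (suc n)) (^[n∸n] w n)
                 (trans (G-suc-left n n k) (cong (_+ (- c) * G (suc n) n k) (G-diagonal n k))) ⟩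
      1# * (c * ((- 1#) * sgn k * (0# + (- c) * G (suc n) n k))) * f (suc n)
        ≡⟨ solve 4 (λ c s B f → 1ₚ :* (c :* ((:- 1ₚ :* s) :* (0ₚ :+ (:- c) :* B))) :* f := c :* (1ₚ :* (c :* (s :* B)) :* f))
                 refl c (sgn k) _ (f (suc n)) ⟩
      c * (1# * (c * (sgn k * G (suc n) n k)) * f (suc n))
        ≡⟨ cong (λ u → c * (u * (c * (sgn k * G (suc n) n k)) * f (suc n))) (^[n∸n] w n) ⟨
      c * Z (suc n) ∎

  recurrence-unique : ∀ w (g g′ h h′ : ℕ → F) → g 0 ≡ 0# → g′ 0 ≡ 0# →
    (∀ n → g (suc n) ≡ w * g n + recip (suc n) * h (suc n)) →
    (∀ n → g′ (suc n) ≡ w * g′ n + recip (suc n) * h′ (suc n)) →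
    (∀ n → h (suc n) ≡ h′ (suc n)) → ∀ n → g n ≡ g′ n
  recurrence-unique w g g′ h h′ g0 g′0 rec rec′ h≗h′ zero    = trans g0 (sym g′0)
  recurrence-unique w g g′ h h′ g0 g′0 rec rec′ h≗h′ (suc n) = begin
    g (suc n)                                  ≡⟨ rec n ⟩
    w * g n + recip (suc n) * h (suc n)        ≡⟨ cong₂ (λ u v → w * u + recip (suc n) * v)
                                                    (recurrence-unique w g g′ h h′ g0 g′0 rec rec′ h≗h′ n) (h≗h′ n) ⟩
    w * g′ n + recip (suc n) * h′ (suc n)      ≡⟨ rec′ n ⟨
    g′ (suc n)                                 ∎

  forcing : F → ℕ → (ℕ → F) → ℕ → F
  forcing w zero    f = f
  forcing w (suc k) f = solution w k f

  solution-suc : ∀ w k f n →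
    solution w k f (suc n) ≡ w * solution w k f n + recip (suc n) * forcing w k f (suc n)
  solution-suc w zero    = solution-zero-suc w
  solution-suc w (suc k) = solution-suc-suc w k

  ≗solution : ∀ w k f (g h : ℕ → F) → g 0 ≡ 0# →
    (∀ n → g (suc n) ≡ w * g n + recip (suc n) * h (suc n)) →
    (∀ n → h (suc n) ≡ forcing w k f (suc n)) → ∀ n → g n ≡ solution w k f n
  ≗solution w k f g h g0 rec h≗ =
    recurrence-unique w g (solution w k f) h (forcing w k f) g0 refl rec (solution-suc w k f) h≗

  -- Binomial transforms

  binomialTransform : F → F → (ℕ → F) → ℕ → F
  binomialTransform y u d n = sum1 n (λ k → u ^ k * y ^ (n ∸ k) * fromℕ (n C k) * d k)

  binomialTransform-cong : ∀ y u {d d′ : ℕ → F} → (∀ k → 1 ℕ.≤ k → d k ≡ d′ k) →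
                           ∀ n → binomialTransform y u d n ≡ binomialTransform y u d′ n
  binomialTransform-cong y u d≗d′ n =
    sum1-cong n (λ k 1≤k _ → cong (u ^ k * y ^ (n ∸ k) * fromℕ (n C k) *_) (d≗d′ k 1≤k))

  binomialTransform-suc : ∀ y u (d : ℕ → F) n → binomialTransform y u d (suc n)
    ≡ y * binomialTransform y u d n + u * sum0 n (λ k → u ^ k * y ^ (n ∸ k) * fromℕ (n C k) * d (suc k))
  binomialTransform-suc y u d n = begin
    binomialTransform y u d (suc n)
      ≡⟨ sum1-suc n _ ⟩
    sum0 n (λ k → u ^ suc k * y ^ (n ∸ k) * fromℕ (suc n C suc k) * d (suc k))
      ≡⟨ sum0-cong n (λ k _ → pascal k) ⟩
    sum0 n (λ k → u * (u ^ k * y ^ (n ∸ k) * fromℕ (n C k) * d (suc k)) + t (suc k))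
      ≡⟨ sum0-+ n _ _ ⟩
    sum0 n (λ k → u * (u ^ k * y ^ (n ∸ k) * fromℕ (n C k) * d (suc k))) + sum0 n (t ∘ suc)
      ≡⟨ cong₂ _+_ (sym (*-distribˡ-sum0 n u _)) (sym (sum1-suc n t)) ⟩
    u * S + (sum1 n t + t (suc n))
      ≡⟨ cong (λ v → u * S + (sum1 n t + v)) t-last ⟩
    u * S + (sum1 n t + 0#)
      ≡⟨ cong (u * S +_) (trans (+-identityʳ _) (trans (sum1-cong n t≡) (sym (*-distribˡ-sum1 n y _)))) ⟩
    u * S + y * binomialTransform y u d n
      ≡⟨ +-comm _ _ ⟩
    y * binomialTransform y u d n + u * S ∎
    where
    S = sum0 n (λ k → u ^ k * y ^ (n ∸ k) * fromℕ (n C k) * d (suc k))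
    t : ℕ → F
    t k = u ^ k * y ^ (suc n ∸ k) * fromℕ (n C k) * d k
    pascal : ∀ k → u ^ suc k * y ^ (n ∸ k) * fromℕ (suc n C suc k) * d (suc k)
                   ≡ u * (u ^ k * y ^ (n ∸ k) * fromℕ (n C k) * d (suc k)) + t (suc k)
    pascal k = begin
      u ^ suc k * y ^ (n ∸ k) * fromℕ (suc n C suc k) * d (suc k)
        ≡⟨ cong (λ v → u ^ suc k * y ^ (n ∸ k) * v * d (suc k))
                (trans (cong fromℕ (sym (nCk+nC[k+1]≡[n+1]C[k+1] n k))) (fromℕ-+ (n C k) (n C suc k))) ⟩
      (u * u ^ k) * y ^ (n ∸ k) * (fromℕ (n C k) + fromℕ (n C suc k)) * d (suc k)
        ≡⟨ solve 6 (λ u U Y c₁ c₂ D → (u :* U) :* Y :* (c₁ :+ c₂) :* D := u :* (U :* Y :* c₁ :* D) :+ (u :* U) :* Y :* c₂ :* D)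
                 refl u (u ^ k) _ _ _ (d (suc k)) ⟩
      u * (u ^ k * y ^ (n ∸ k) * fromℕ (n C k) * d (suc k)) + t (suc k) ∎
    t-last : t (suc n) ≡ 0#
    t-last = trans (cong (λ c → u ^ suc n * y ^ (n ∸ n) * fromℕ c * d (suc n)) (k>n⇒nCk≡0 (ℕ.n<1+n n)))
                   (trans (cong (_* d (suc n)) (zeroʳ _)) (zeroˡ _))
    t≡ : ∀ k → 1 ℕ.≤ k → k ℕ.≤ n → t k ≡ y * (u ^ k * y ^ (n ∸ k) * fromℕ (n C k) * d k)
    t≡ k _ k≤n = trans (cong (λ v → u ^ k * v * fromℕ (n C k) * d k) (^[1+n∸j] y k≤n))
      (solve 5 (λ U y Y c D → U :* (y :* Y) :* c :* D := y :* (U :* Y :* c :* D)) refl (u ^ k) y _ _ (d k))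

  binomialTransform-recurrence : ∀ y u c (a b : ℕ → F) → c * a 0 ≡ 0# →
    (∀ k → a (suc k) ≡ c * a k + recip (suc k) * b (suc k)) → ∀ n →
    binomialTransform y u a (suc n)
      ≡ (y + c * u) * binomialTransform y u a n + recip (suc n) * binomialTransform y u b (suc n)
  binomialTransform-recurrence y u c a b ca0≡0 a-rec n = begin
    binomialTransform y u a (suc n)
      ≡⟨ binomialTransform-suc y u a n ⟩
    y * T + u * sum0 n (λ k → Q k * a (suc k))
      ≡⟨ cong (λ v → y * T + u * v) (trans (sum0-cong n (λ k _ → trans (cong (Q k *_) (a-rec k)) (distribˡ _ _ _)))
                                           (sum0-+ n _ _)) ⟩
    y * T + u * (sum0 n (λ k → Q k * (c * a k)) + sum0 n (λ k → Q k * (recip (suc k) * b (suc k))))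
      ≡⟨ cong (y * T +_) (trans (distribˡ _ _ _) (cong₂ _+_ homogeneous-part driven-part)) ⟩
    y * T + ((c * u) * T + recip (suc n) * binomialTransform y u b (suc n))
      ≡⟨ solve 5 (λ y T cu r B → y :* T :+ (cu :* T :+ r :* B) := (y :+ cu) :* T :+ r :* B) refl y T (c * u) _ _ ⟩
    (y + c * u) * T + recip (suc n) * binomialTransform y u b (suc n) ∎
    where
    T = binomialTransform y u a n
    Q : ℕ → F
    Q k = u ^ k * y ^ (n ∸ k) * fromℕ (n C k)
    homogeneous-part : u * sum0 n (λ k → Q k * (c * a k)) ≡ (c * u) * T
    homogeneous-part = begin
      u * sum0 n (λ k → Q k * (c * a k))
        ≡⟨ cong (u *_) (sum0-cong n (λ k _ → solve 3 (λ q c a → q :* (c :* a) := c :* (q :* a)) refl (Q k) c (a k))) ⟩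
      u * sum0 n (λ k → c * (Q k * a k))      ≡⟨ cong (u *_) (*-distribˡ-sum0 n c _) ⟨
      u * (c * sum0 n (λ k → Q k * a k))      ≡⟨ cong (λ v → u * (c * v)) (sum0≡f0+sum1 n _) ⟩
      u * (c * (Q 0 * a 0 + T))
        ≡⟨ solve 5 (λ u c q a T → u :* (c :* (q :* a :+ T)) := u :* q :* (c :* a) :+ (c :* u) :* T) refl u c (Q 0) (a 0) T ⟩
      u * Q 0 * (c * a 0) + (c * u) * T       ≡⟨ cong (λ v → u * Q 0 * v + (c * u) * T) ca0≡0 ⟩
      u * Q 0 * 0# + (c * u) * T              ≡⟨ trans (cong (_+ (c * u) * T) (zeroʳ _)) (+-identityˡ _) ⟩
      (c * u) * T                             ∎
    driven-part : u * sum0 n (λ k → Q k * (recip (suc k) * b (suc k))) ≡ recip (suc n) * binomialTransform y u b (suc n)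
    driven-part = begin
      u * sum0 n (λ k → Q k * (recip (suc k) * b (suc k)))
        ≡⟨ *-distribˡ-sum0 n u _ ⟩
      sum0 n (λ k → u * (Q k * (recip (suc k) * b (suc k))))
        ≡⟨ sum0-cong n (λ k _ → absorb k) ⟩
      sum0 n (λ k → recip (suc n) * (u ^ suc k * y ^ (n ∸ k) * fromℕ (suc n C suc k) * b (suc k)))
        ≡⟨ *-distribˡ-sum0 n (recip (suc n)) _ ⟨
      recip (suc n) * sum0 n (λ k → u ^ suc k * y ^ (n ∸ k) * fromℕ (suc n C suc k) * b (suc k))
        ≡⟨ cong (recip (suc n) *_) (sum1-suc n _) ⟨
      recip (suc n) * binomialTransform y u b (suc n) ∎
      where
      absorb : ∀ k → u * (Q k * (recip (suc k) * b (suc k)))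
                     ≡ recip (suc n) * (u ^ suc k * y ^ (n ∸ k) * fromℕ (suc n C suc k) * b (suc k))
      absorb k = begin
        u * (u ^ k * y ^ (n ∸ k) * fromℕ (n C k) * (recip (suc k) * b (suc k)))
          ≡⟨ solve 6 (λ u U Y c r B → u :* (U :* Y :* c :* (r :* B)) := (u :* U) :* Y :* (c :* r) :* B) refl u (u ^ k) _ _ _ _ ⟩
        u ^ suc k * y ^ (n ∸ k) * (fromℕ (n C k) * recip (suc k)) * b (suc k)
          ≡⟨ cong (λ v → u ^ suc k * y ^ (n ∸ k) * v * b (suc k)) (nCk/[1+k]≡[1+n]C[1+k]/[1+n] n k) ⟩
        u ^ suc k * y ^ (n ∸ k) * (recip (suc n) * fromℕ (suc n C suc k)) * b (suc k)
          ≡⟨ solve 5 (λ U Y r c B → U :* Y :* (r :* c) :* B := r :* (U :* Y :* c :* B)) refl (u ^ suc k) _ _ _ _ ⟩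
        recip (suc n) * (u ^ suc k * y ^ (n ∸ k) * fromℕ (suc n C suc k) * b (suc k)) ∎

  binomialTransform-one : ∀ y u n → binomialTransform y u (λ _ → 1#) n ≡ ((u + y) ^ n) - (y ^ n)
  binomialTransform-one y u zero    = sym (-‿inverseʳ 1#)
  binomialTransform-one y u (suc n) = begin
    binomialTransform y u (λ _ → 1#) (suc n)
      ≡⟨ binomialTransform-suc y u (λ _ → 1#) n ⟩
    y * T + u * sum0 n (λ k → u ^ k * y ^ (n ∸ k) * fromℕ (n C k) * 1#)
      ≡⟨ cong₂ (λ s t → y * s + u * t) (binomialTransform-one y u n) (sum0≡f0+sum1 n _) ⟩
    y * (((u + y) ^ n) - (y ^ n)) + u * (1# * y ^ n * fromℕ 1 * 1# + T)
      ≡⟨ cong₂ (λ s t → y * (((u + y) ^ n) - (y ^ n)) + u * (1# * y ^ n * s * 1# + t)) fromℕ-1 (binomialTransform-one y u n) ⟩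
    y * (((u + y) ^ n) - (y ^ n)) + u * (1# * y ^ n * 1# * 1# + (((u + y) ^ n) - (y ^ n)))
      ≡⟨ solve 4 (λ y u A Y → y :* (A :- Y) :+ u :* (1ₚ :* Y :* 1ₚ :* 1ₚ :+ (A :- Y)) := (u :+ y) :* A :- y :* Y)
               refl y u ((u + y) ^ n) (y ^ n) ⟩
    ((u + y) ^ suc n) - (y ^ suc n) ∎
    where T = binomialTransform y u (λ _ → 1#) n

  invPow-suc : ∀ j m → invPow (suc j) (suc m) ≡ recip (suc j) * invPow (suc j) m
  invPow-suc j m = ⁻¹-distrib-* _ _ (fromℕ-suc≢0 j) (^-≢0 m (fromℕ-suc≢0 j))

  binomialTransform-invPow-suc : ∀ y u m n →
    binomialTransform y u (λ k → invPow k (suc m)) (suc n)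
      ≡ y * binomialTransform y u (λ k → invPow k (suc m)) n
        + recip (suc n) * binomialTransform y u (λ k → invPow k m) (suc n)
  binomialTransform-invPow-suc y u m n = trans
    (binomialTransform-recurrence y u 0# (λ k → invPow k (suc m)) (λ k → invPow k m) (zeroˡ _)
      (λ k → trans (invPow-suc k m) (sym (trans (cong (_+ recip (suc k) * invPow (suc k) m) (zeroˡ _)) (+-identityˡ _)))) n)
    (cong (λ v → v * binomialTransform y u (λ k → invPow k (suc m)) n
                 + recip (suc n) * binomialTransform y u (λ k → invPow k m) (suc n))
          (trans (cong (y +_) (zeroˡ u)) (+-identityʳ y)))

  binomialTransform-invPow : ∀ y u m n → binomialTransform y u (λ k → invPow k (suc m)) n
                             ≡ solution y m (λ l → ((u + y) ^ l) - (y ^ l)) n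
  binomialTransform-invPow y u zero    =
    ≗solution y 0 _ (binomialTransform y u (λ k → invPow k 1)) (binomialTransform y u (λ k → invPow k 0))
      refl (binomialTransform-invPow-suc y u 0)
      (λ n → trans (binomialTransform-cong y u (λ _ _ → 1⁻¹≡1) (suc n)) (binomialTransform-one y u (suc n)))
  binomialTransform-invPow y u (suc m) =
    ≗solution y (suc m) _ (binomialTransform y u (λ k → invPow k (suc (suc m)))) (binomialTransform y u (λ k → invPow k (suc m)))
      refl (binomialTransform-invPow-suc y u (suc m)) (λ n → binomialTransform-invPow y u m (suc n))

  binomialTransform-accumulate : ∀ y u (a b : ℕ → F) → a 0 ≡ 0# →
    (∀ k → a (suc k) ≡ a k + recip (suc k) * b (suc k)) → ∀ n →
    binomialTransform y u a (suc n) ≡ (u + y) * binomialTransform y u a n + recip (suc n) * binomialTransform y u b (suc n)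
  binomialTransform-accumulate y u a b a0≡0 a-rec n = trans
    (binomialTransform-recurrence y u 1# a b (trans (*-identityˡ _) a0≡0)
      (λ k → trans (a-rec k) (cong (_+ recip (suc k) * b (suc k)) (sym (*-identityˡ _)))) n)
    (cong (λ v → v * binomialTransform y u a n + recip (suc n) * binomialTransform y u b (suc n))
          (trans (cong (y +_) (*-identityˡ u)) (+-comm y u)))

  zsAux-comp : ∀ z j p m n → zsAux z j (comp (suc p) m) n ≡ zetaStar n (comp (suc p) m) z
  zsAux-comp z j zero    m n = refl
  zsAux-comp z j (suc p) m n = refl

  zetaStar-zero : ∀ p m z → zetaStar 0 (comp (suc p) m) z ≡ 0#
  zetaStar-zero zero    m z = refl
  zetaStar-zero (suc p) m z = refl

  binomialTransform-zetaStar : ∀ x y z m p n →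
    binomialTransform y x (λ k → zetaStar k (comp (suc p) m) z) n
      ≡ solution (x + y) p (binomialTransform y (x * z) (λ k → invPow k m)) n
  binomialTransform-zetaStar x y z m zero =
    ≗solution (x + y) 0 _ _ (binomialTransform y x (λ k → invPow k m * z ^ k)) refl
      (binomialTransform-accumulate y x _ _ refl (λ k → cong (zetaStar k (comp 1 m) z +_)
        (trans (cong (_* z ^ suc k) (invPow-suc k m)) (*-assoc _ _ _))))
      (λ n → sum1-cong (suc n) (λ k _ _ → begin
        x ^ k * y ^ (suc n ∸ k) * fromℕ (suc n C k) * (invPow k m * z ^ k)
          ≡⟨ solve 5 (λ X Y c I Z → X :* Y :* c :* (I :* Z) := (X :* Z) :* Y :* c :* I) refl (x ^ k) _ _ _ (z ^ k) ⟩
        (x ^ k * z ^ k) * y ^ (suc n ∸ k) * fromℕ (suc n C k) * invPow k m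
          ≡⟨ cong (λ v → v * y ^ (suc n ∸ k) * fromℕ (suc n C k) * invPow k m) (^-distribʳ-* x z k) ⟨
        (x * z) ^ k * y ^ (suc n ∸ k) * fromℕ (suc n C k) * invPow k m ∎))
  binomialTransform-zetaStar x y z m (suc p) =
    ≗solution (x + y) (suc p) _ _ (binomialTransform y x (λ k → zetaStar k (comp (suc p) m) z)) refl
      (binomialTransform-accumulate y x _ _ refl
        (λ k → cong₂ (λ u v → zetaStar k (comp (suc (suc p)) m) z + u * v)
                     (cong _⁻¹ (*-identityʳ _)) (zsAux-comp z (suc k) p m (suc k))))
      (λ n → binomialTransform-zetaStar x y z m p (suc n))

  binomialSum-zetaStar : ∀ x y z p m n →
    sum0 n (λ k → x ^ k * y ^ (n ∸ k) * fromℕ (n C k) * zetaStar k (comp (suc p) m) z)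
      ≡ binomialTransform y x (λ k → zetaStar k (comp (suc p) m) z) n
  binomialSum-zetaStar x y z p m n = begin
    sum0 n _                                         ≡⟨ sum0≡f0+sum1 n _ ⟩
    c₀ * zetaStar 0 (comp (suc p) m) z + T           ≡⟨ cong (λ t → c₀ * t + T) (zetaStar-zero p m z) ⟩
    c₀ * 0# + T                                      ≡⟨ cong (_+ T) (zeroʳ c₀) ⟩
    0# + T                                           ≡⟨ +-identityˡ T ⟩
    T                                                ∎
    where
    c₀ = 1# * y ^ n * fromℕ 1
    T  = binomialTransform y x (λ k → zetaStar k (comp (suc p) m) z) n

  stirlingBellSum : ℕ → ℕ → ℕ → F
  stirlingBellSum a j p =
    sum0 (p ∸ 1) (λ i → sgn i * Y i a * (fromℕ (i !) ⁻¹) * fromℕ (stirling j (p ∸ i)) * (fromℕ (j !) ⁻¹))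

  stirlingBellSum≡recip*G : ∀ a b k → stirlingBellSum a (suc b) (suc k) ≡ recip (suc b) * G a b k
  stirlingBellSum≡recip*G a b k = trans (sum0-cong k (λ i i≤k → begin
      sgn i * Y i a * fromℕ (i !) ⁻¹ * fromℕ (stirling (suc b) (suc k ∸ i)) * fromℕ (suc b !) ⁻¹
        ≡⟨ cong₂ (λ s t → sgn i * Y i a * fromℕ (i !) ⁻¹ * fromℕ (stirling (suc b) s) * t) (ℕ.+-∸-assoc 1 i≤k) (1/[1+n]! b) ⟩
      sgn i * Y i a * fromℕ (i !) ⁻¹ * fromℕ (stirling (suc b) (suc (k ∸ i))) * (recip (suc b) * fromℕ (b !) ⁻¹)
        ≡⟨ solve 6 (λ s y f S r g → s :* y :* f :* S :* (r :* g) := r :* (s :* (y :* f) :* (S :* g))) refl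
                 (sgn i) (Y i a) (fromℕ (i !) ⁻¹) _ (recip (suc b)) _ ⟩
      recip (suc b) * (sgn i * (Y i a * fromℕ (i !) ⁻¹) * elementary b (k ∸ i))
        ≡⟨ cong (λ h → recip (suc b) * (sgn i * h * elementary b (k ∸ i))) (Y/!≡complete a i) ⟩
      recip (suc b) * (sgn i * complete a i * elementary b (k ∸ i)) ∎))
    (sym (*-distribˡ-sum0 k (recip (suc b)) _))

  a^n*[b/a]^j≡a^[n∸j]*b^j : ∀ a b {n j} → ¬ (a ≡ 0#) → j ℕ.≤ n → a ^ n * (b * a ⁻¹) ^ j ≡ a ^ (n ∸ j) * b ^ j
  a^n*[b/a]^j≡a^[n∸j]*b^j a b {n} {j} a≢0 j≤n = begin
    a ^ n * (b * a ⁻¹) ^ j                            ≡⟨ cong₂ _*_ (^-∸ a j≤n) (^-distribʳ-* b (a ⁻¹) j) ⟩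
    (a ^ (n ∸ j) * a ^ j) * (b ^ j * (a ⁻¹) ^ j)      ≡⟨ solve 4 (λ A B C D → (A :* B) :* (C :* D) := A :* C :* (B :* D)) refl _ _ _ _ ⟩
    a ^ (n ∸ j) * b ^ j * (a ^ j * (a ⁻¹) ^ j)        ≡⟨ cong (a ^ (n ∸ j) * b ^ j *_) (trans (sym (^-distribʳ-* a (a ⁻¹) j))
                                                           (trans (cong (_^ j) (inverseʳ a a≢0)) (1^n≡1 j))) ⟩
    a ^ (n ∸ j) * b ^ j * 1#                          ≡⟨ *-identityʳ _ ⟩
    a ^ (n ∸ j) * b ^ j                               ∎

  y^j*[[1+c/y]^l-1]≡y^[j∸l]*[[c+y]^l-y^l] : ∀ c y {j l} → ¬ (y ≡ 0#) → l ℕ.≤ j →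
    y ^ j * (((1# + c * y ⁻¹) ^ l) - 1#) ≡ y ^ (j ∸ l) * (((c + y) ^ l) - (y ^ l))
  y^j*[[1+c/y]^l-1]≡y^[j∸l]*[[c+y]^l-y^l] c y {j} {l} y≢0 l≤j = begin
    y ^ j * ((ρ ^ l) - 1#)                        ≡⟨ cong (_* ((ρ ^ l) - 1#)) (^-∸ y l≤j) ⟩
    (y ^ (j ∸ l) * y ^ l) * ((ρ ^ l) - 1#)        ≡⟨ solve 3 (λ A B C → (A :* B) :* (C :- 1ₚ) := A :* (B :* C :- B)) refl _ _ _ ⟩
    y ^ (j ∸ l) * ((y ^ l * ρ ^ l) - (y ^ l))     ≡⟨ cong (λ t → y ^ (j ∸ l) * (t - (y ^ l)))
                                                       (trans (sym (^-distribʳ-* y ρ l)) (cong (_^ l) yρ≡c+y)) ⟩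
    y ^ (j ∸ l) * (((c + y) ^ l) - (y ^ l))       ∎
    where
    ρ = 1# + c * y ⁻¹
    yρ≡c+y : y * ρ ≡ c + y
    yρ≡c+y = begin
      y * (1# + c * y ⁻¹)   ≡⟨ solve 3 (λ y c y' → y :* (1ₚ :+ c :* y') := c :* (y :* y') :+ y) refl y c (y ⁻¹) ⟩
      c * (y * y ⁻¹) + y    ≡⟨ cong (λ t → c * t + y) (inverseʳ y y≢0) ⟩
      c * 1# + y            ≡⟨ cong (_+ y) (*-identityʳ c) ⟩
      c + y                 ∎

  sgn[1+m+1+p]≡sgn[p]*sgn[m] : ∀ m p → sgn (suc m ℕ.+ suc p) ≡ sgn p * sgn m
  sgn[1+m+1+p]≡sgn[p]*sgn[m] m p = begin
    (- 1#) * sgn (m ℕ.+ suc p)         ≡⟨ cong ((- 1#) *_) (^-+ (- 1#) m (suc p)) ⟩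
    (- 1#) * (sgn m * ((- 1#) * sgn p)) ≡⟨ solve 2 (λ a b → (:- 1ₚ) :* (a :* ((:- 1ₚ) :* b)) := b :* a) refl (sgn m) (sgn p) ⟩
    sgn p * sgn m                       ∎

  summand≡kernel*kernel : ∀ x y z n b c m p → ¬ (y ≡ 0#) → ¬ (x + y ≡ 0#) → suc c ℕ.≤ suc b → suc b ℕ.≤ n →
    sgn (suc m ℕ.+ suc p) * ((x + y) ^ n)
      * (((y * ((x + y) ⁻¹)) ^ suc b) * (((1# + x * z * (y ⁻¹)) ^ suc c) - 1#)
         * stirlingBellSum n (suc b) (suc p) * stirlingBellSum (suc b) (suc c) (suc m))
    ≡ kernel (x + y) p n (suc b) * (kernel y m (suc b) (suc c) * (((x * z + y) ^ suc c) - (y ^ suc c)))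
  summand≡kernel*kernel x y z n b c m p y≢0 x+y≢0 l≤j j≤n = begin
    σ * (x + y) ^ n * (V * ρ * stirlingBellSum n (suc b) (suc p) * stirlingBellSum (suc b) (suc c) (suc m))
      ≡⟨ cong₂ (λ s t → σ * (x + y) ^ n * (V * ρ * s * t)) (stirlingBellSum≡recip*G n b p) (stirlingBellSum≡recip*G (suc b) c m) ⟩
    σ * (x + y) ^ n * (V * ρ * (rⱼ * G₁) * (rₗ * G₂))
      ≡⟨ solve 8 (λ σ X V ρ r g r′ g′ → σ :* X :* (V :* ρ :* (r :* g) :* (r′ :* g′))
                                        := σ :* (X :* V) :* ρ :* (r :* g) :* (r′ :* g′))
               refl σ _ V ρ rⱼ G₁ rₗ G₂ ⟩
    σ * ((x + y) ^ n * V) * ρ * (rⱼ * G₁) * (rₗ * G₂)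
      ≡⟨ cong₂ (λ s t → s * t * ρ * (rⱼ * G₁) * (rₗ * G₂))
               (sgn[1+m+1+p]≡sgn[p]*sgn[m] m p) (a^n*[b/a]^j≡a^[n∸j]*b^j (x + y) y x+y≢0 j≤n) ⟩
    (sgn p * sgn m) * ((x + y) ^ (n ∸ suc b) * y ^ suc b) * ρ * (rⱼ * G₁) * (rₗ * G₂)
      ≡⟨ solve 9 (λ sp sm W Y ρ r g r′ g′ → (sp :* sm) :* (W :* Y) :* ρ :* (r :* g) :* (r′ :* g′)
                                            := (W :* (r :* (sp :* g))) :* (r′ :* (sm :* g′)) :* (Y :* ρ))
               refl (sgn p) (sgn m) _ _ ρ rⱼ G₁ rₗ G₂ ⟩
    kernel (x + y) p n (suc b) * (rₗ * (sgn m * G₂)) * (y ^ suc b * ρ)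
      ≡⟨ cong (kernel (x + y) p n (suc b) * (rₗ * (sgn m * G₂)) *_) (y^j*[[1+c/y]^l-1]≡y^[j∸l]*[[c+y]^l-y^l] (x * z) y y≢0 l≤j) ⟩
    kernel (x + y) p n (suc b) * (rₗ * (sgn m * G₂)) * (y ^ (b ∸ c) * Δ)
      ≡⟨ solve 4 (λ A B Y D → A :* B :* (Y :* D) := A :* (Y :* B :* D)) refl _ _ _ Δ ⟩
    kernel (x + y) p n (suc b) * (kernel y m (suc b) (suc c) * Δ) ∎
    where
    σ  = sgn (suc m ℕ.+ suc p)
    V  = (y * (x + y) ⁻¹) ^ suc b
    ρ  = ((1# + x * z * y ⁻¹) ^ suc c) - 1#
    Δ  = ((x * z + y) ^ suc c) - (y ^ suc c)
    rⱼ = recip (suc b)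
    rₗ = recip (suc c)
    G₁ = G n b p
    G₂ = G (suc b) c m

theorem1p2 : (𝔽 : OrderedField) → let open OF 𝔽 in
    (x y z : F) → ¬ (y ≡ 0#) → ¬ (x + y ≡ 0#) → 0# ≤ x * ((x + y) ⁻¹) → z ≤ 1# →
    (n p m : ℕ) → n ≥ 1 → p ≥ 1 → m ≥ 1 →
    sum0 n (λ k → (x ^ k) * (y ^ (n ∸ k)) * fromℕ (n C k) * zetaStar k (comp p m) z)
    ≡ sgn (m ℕ.+ p) * ((x + y) ^ n) *
      sum1 n (λ j → sum1 j (λ l →
        ((y * ((x + y) ⁻¹)) ^ j) * (((1# + x * z * (y ⁻¹)) ^ l) - 1#)
        * sum0 (p ∸ 1) (λ i → sgn i * Y i n * (fromℕ (i !) ⁻¹)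
                              * fromℕ (stirling j (p ∸ i)) * (fromℕ (j !) ⁻¹))
        * sum0 (m ∸ 1) (λ h → sgn h * Y h j * (fromℕ (h !) ⁻¹)
                              * fromℕ (stirling l (m ∸ h)) * (fromℕ (l !) ⁻¹))))
theorem1p2 𝔽 x y z y≢0 x+y≢0 _ _ n (suc p) (suc m) _ _ _ = begin
  sum0 n (λ k → x ^ k * y ^ (n ∸ k) * fromℕ (n C k) * zetaStar k (comp (suc p) (suc m)) z)
    ≡⟨ binomialSum-zetaStar x y z p (suc m) n ⟩
  binomialTransform y x (λ k → zetaStar k (comp (suc p) (suc m)) z) n
    ≡⟨ binomialTransform-zetaStar x y z (suc m) p n ⟩
  solution (x + y) p (binomialTransform y (x * z) (λ k → invPow k (suc m))) n
    ≡⟨ sum1-cong n (λ j _ _ → cong (kernel (x + y) p n j *_) (binomialTransform-invPow y (x * z) m j)) ⟩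
  sum1 n (λ j → kernel (x + y) p n j * solution y m Δ j)
    ≡⟨ sum1-cong n (λ j _ _ → *-distribˡ-sum1 j _ _) ⟩
  sum1 n (λ j → sum1 j (λ l → kernel (x + y) p n j * (kernel y m j l * Δ l)))
    ≡⟨ sum1-cong n (λ { (suc b) _ j≤n → sum1-cong (suc b) (λ { (suc c) _ l≤j →
         sym (summand≡kernel*kernel x y z n b c m p y≢0 x+y≢0 l≤j j≤n) }) }) ⟩
  sum1 n (λ j → sum1 j (λ l → K * term j l))
    ≡⟨ sym (trans (*-distribˡ-sum1 n K _) (sum1-cong n (λ j _ _ → *-distribˡ-sum1 j K _))) ⟩
  K * sum1 n (λ j → sum1 j (term j)) ∎
  where
  open Lemmas 𝔽
  open ≡-Reasoning
  Δ : ℕ → F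
  Δ l = ((x * z + y) ^ l) - (y ^ l)
  K = sgn (suc m ℕ.+ suc p) * ((x + y) ^ n)
  term : ℕ → ℕ → F
  term j l = ((y * ((x + y) ⁻¹)) ^ j) * (((1# + x * z * (y ⁻¹)) ^ l) - 1#)
             * stirlingBellSum n j (suc p) * stirlingBellSum j l (suc m)
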